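{- Let $\mathbf A$ be a connexive Heyting algebra. For all $a,b,c\in A$: (1) $(a\rightarrow b)\wedge(b\rightarrow c)\le a\rightarrow c$; (2) $(a\rightarrow b)\rightarrow((c\rightarrow a)\rightarrow(c\rightarrow b))=1$; (3) if $a\le b$ then $\neg b\le\neg a$; (4) $a\le a\rightarrow 1\le b\rightarrow(a\rightarrow b)$; (5) if $\neg a=1$ then $a=0$; (6) $\neg(a\rightarrow\neg a)=1$; (7) $a\rightarrow\neg a=0=\neg a\rightarrow a$; (8) $(a\rightarrow b)\wedge(a\rightarrow\neg b)=0$; (9) $(a\rightarrow b)\rightarrow(a\rightarrow\neg b)=0$; (10) $(a\rightarrow 1)\rightarrow\neg a=0$; (11) $0\rightarrow a=(a\rightarrow 0)\rightarrow 1$; (12) $a\rightarrow\neg\neg a=1$; (13) $0\rightarrow a=a\rightarrow 0$; (14) $\neg b=\neg((b\rightarrow a)\rightarrow a)=\neg a\rightarrow(b\rightarrow a)$; (15) $(a\rightarrow 1)\wedge\neg a=0$; (16) $\neg a=(a\rightarrow 1)\rightarrow 0$; (17) $(a\rightarrow b)\rightarrow 1=\neg(a\rightarrow\neg b)$; (18) $\neg\neg a=a\rightarrow 1$; (19) $\neg(a\rightarrow b)=\neg(b\rightarrow a)$; (20) $\neg(a\rightarrow b)=a\rightarrow\neg b$; (21) $a\rightarrow b=0$ if and only if $a\rightarrow\neg b=1$; (22) $a\rightarrow b=1$ implies $a\rightarrow\neg b=0$.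
   Context: A connexive Heyting algebra is an algebra $\langle A,\wedge,\vee,\rightarrow,0,1\rangle$ whose $\{\wedge,\vee,0,1\}$-reduct is a bounded distributive lattice with lattice order $\le$, satisfying, with $\neg x:=x\rightarrow0$: (C1) $(x\rightarrow y)\rightarrow((y\rightarrow z)\rightarrow(x\rightarrow z))=1$; (C2) $(x\rightarrow y)\rightarrow\neg(x\rightarrow\neg y)=1$; (C3) $x\wedge(x\rightarrow y)=x\wedge y$; (C4) $x\rightarrow y\le(z\wedge x)\rightarrow(z\wedge y)$; (C5) $x\rightarrow y\le(z\vee x)\rightarrow(z\vee y)$. -}

module Defs where

open import Level using (suc)
open import Relation.Binary.PropositionalEquality using (_≡_)
open import Algebra.Core using (Op₂)
open import Algebra.Lattice.Structures using (IsDistributiveLattice)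

record ConnexiveHeytingAlgebra (c : Level.Level) : Set (suc c) where
  infixr 7 _∧_
  infixr 6 _∨_
  infixr 5 _⇒_
  infix  4 _≤_
  field
    Carrier : Set c
    _∧_ _∨_ _⇒_ : Op₂ Carrier
    𝟘 𝟙 : Carrier
    isDistributiveLattice : IsDistributiveLattice _≡_ _∨_ _∧_

  _≤_ : Carrier → Carrier → Set c
  x ≤ y = x ∧ y ≡ x

  ¬_ : Carrier → Carrier
  ¬ x = x ⇒ 𝟘

  field
    𝟘-least    : ∀ x → 𝟘 ≤ x
    𝟙-greatest : ∀ x → x ≤ 𝟙
    C1 : ∀ x y z → (x ⇒ y) ⇒ ((y ⇒ z) ⇒ (x ⇒ z)) ≡ 𝟙
    C2 : ∀ x y → (x ⇒ y) ⇒ (¬ (x ⇒ ¬ y)) ≡ 𝟙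
    C3 : ∀ x y → x ∧ (x ⇒ y) ≡ x ∧ y
    C4 : ∀ x y z → x ⇒ y ≤ (z ∧ x) ⇒ (z ∧ y)
    C5 : ∀ x y z → x ⇒ y ≤ (z ∨ x) ⇒ (z ∨ y)

{-# OPTIONS --safe #-}
-- Writing x ≼ y for
-- x ⇒ y ≡ 𝟙: C3 turns x ≼ y into x ≤ y; C2 at 𝟙 gives x ≼ ¬ ¬ x; and C4 at 𝟙 gives
-- x ≤ y ⇒ (y ∧ x), which makes ¬ y the largest element meeting y in 𝟘, so ¬ is a
-- pseudocomplement. From these, ¬ x = 𝟘 ⇒ x = ¬ x ⇒ 𝟙 and ¬ ¬ x = x ⇒ 𝟙 follow by squeezing.
-- The substantial items, ¬ (a ⇒ b) = a ⇒ ¬ b and prefixing (2), need a way to bound an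
-- element below an implication: z ≤ x ⇒ y as soon as x ∧ z ≤ y and z ∧ ¬ x ∧ y = 𝟘. This
-- introduction rule factors x ⇒ y through x ∧ y and is the one place where C5 is used.
module Submission where

open import Defs
open import Level using (Level)
open import Data.Product using (_×_; _,_)
open import Function.Bundles using (_⇔_; mk⇔)
open import Relation.Binary.PropositionalEquality
  using (_≡_; refl; sym; trans; cong; cong₂; subst; subst₂; isEquivalence)
open import Relation.Binary.Bundles using (Poset)
open import Algebra.Lattice.Bundles using (DistributiveLattice)
open import Algebra.Lattice.Properties.Lattice using (∨-∧-orderTheoreticLattice)
import Relation.Binary.Lattice.Bundles as OrderTheoretic
import Relation.Binary.Reasoning.PartialOrder as PartialOrderReasoning

module ConnexiveHeytingAlgebraProperties {ℓ : Level} (A : ConnexiveHeytingAlgebra ℓ) where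
  open ConnexiveHeytingAlgebra A

  distributiveLattice : DistributiveLattice ℓ ℓ
  distributiveLattice = record { isDistributiveLattice = isDistributiveLattice }

  open DistributiveLattice distributiveLattice
    using (lattice; ∧-comm; ∧-distribˡ-∨; ∨-absorbs-∧)

  -- The library orders a lattice by x ≡ x ∧ y, the symmetric form of _≤_.
  private
    module Natural = OrderTheoretic.Lattice (∨-∧-orderTheoreticLattice lattice)

  ≤-refl : ∀ {x} → x ≤ x
  ≤-refl = sym Natural.refl

  ≤-reflexive : ∀ {x y} → x ≡ y → x ≤ y
  ≤-reflexive refl = ≤-refl

  ≤-trans : ∀ {x y z} → x ≤ y → y ≤ z → x ≤ z
  ≤-trans p q = sym (Natural.trans (sym p) (sym q))

  ≤-antisym : ∀ {x y} → x ≤ y → y ≤ x → x ≡ y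
  ≤-antisym p q = Natural.antisym (sym p) (sym q)

  x∧y≤x : ∀ x y → x ∧ y ≤ x
  x∧y≤x x y = sym (Natural.x∧y≤x x y)

  x∧y≤y : ∀ x y → x ∧ y ≤ y
  x∧y≤y x y = sym (Natural.x∧y≤y x y)

  ∧-greatest : ∀ {x y z} → x ≤ y → x ≤ z → x ≤ y ∧ z
  ∧-greatest p q = sym (Natural.∧-greatest (sym p) (sym q))

  x≤x∨y : ∀ x y → x ≤ x ∨ y
  x≤x∨y x y = sym (Natural.x≤x∨y x y)

  y≤x∨y : ∀ x y → y ≤ x ∨ y
  y≤x∨y x y = sym (Natural.y≤x∨y x y)

  ∨-least : ∀ {x y z} → x ≤ z → y ≤ z → x ∨ y ≤ z
  ∨-least p q = sym (Natural.∨-least (sym p) (sym q))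

  ∧-mono-≤ : ∀ {x x′ y y′} → x ≤ x′ → y ≤ y′ → x ∧ y ≤ x′ ∧ y′
  ∧-mono-≤ p q = ∧-greatest (≤-trans (x∧y≤x _ _) p) (≤-trans (x∧y≤y _ _) q)

  poset : Poset ℓ ℓ ℓ
  poset = record
    { isPartialOrder = record
      { isPreorder = record
        { isEquivalence = isEquivalence
        ; reflexive     = ≤-reflexive
        ; trans         = ≤-trans
        }
      ; antisym = ≤-antisym
      }
    }

  open PartialOrderReasoning poset

  𝟙∧x≡x : ∀ x → 𝟙 ∧ x ≡ x
  𝟙∧x≡x x = trans (∧-comm 𝟙 x) (𝟙-greatest x)

  x∧𝟘≡𝟘 : ∀ x → x ∧ 𝟘 ≡ 𝟘
  x∧𝟘≡𝟘 x = trans (∧-comm x 𝟘) (𝟘-least x)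

  x≤𝟘⇒x≡𝟘 : ∀ {x} → x ≤ 𝟘 → x ≡ 𝟘
  x≤𝟘⇒x≡𝟘 {x} p = ≤-antisym p (𝟘-least x)

  𝟙≤x⇒x≡𝟙 : ∀ {x} → 𝟙 ≤ x → x ≡ 𝟙
  𝟙≤x⇒x≡𝟙 {x} p = ≤-antisym (𝟙-greatest x) p

  x∨𝟘≡x : ∀ x → x ∨ 𝟘 ≡ x
  x∨𝟘≡x x = trans (cong (x ∨_) (sym (x∧𝟘≡𝟘 x))) (∨-absorbs-∧ x 𝟘)

  infix 4 _≼_

  _≼_ : Carrier → Carrier → Set ℓ
  x ≼ y = x ⇒ y ≡ 𝟙

  𝟙⇒x≡x : ∀ x → 𝟙 ⇒ x ≡ x
  𝟙⇒x≡x x = begin-equality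
    𝟙 ⇒ x         ≡⟨ 𝟙∧x≡x (𝟙 ⇒ x) ⟨
    𝟙 ∧ (𝟙 ⇒ x)   ≡⟨ C3 𝟙 x ⟩
    𝟙 ∧ x         ≡⟨ 𝟙∧x≡x x ⟩
    x             ∎

  ≼-mp : ∀ {x y} → x ≡ 𝟙 → x ≼ y → y ≡ 𝟙
  ≼-mp refl e = trans (sym (𝟙⇒x≡x _)) e

  x∧[x⇒y]≤y : ∀ x y → x ∧ (x ⇒ y) ≤ y
  x∧[x⇒y]≤y x y = ≤-trans (≤-reflexive (C3 x y)) (x∧y≤y x y)

  x∧y≤x⇒y : ∀ x y → x ∧ y ≤ x ⇒ y
  x∧y≤x⇒y x y = ≤-trans (≤-reflexive (sym (C3 x y))) (x∧y≤y x (x ⇒ y))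

  ≼⇒≤ : ∀ {x y} → x ≼ y → x ≤ y
  ≼⇒≤ {x} {y} e = begin
    x             ≡⟨ 𝟙-greatest x ⟨
    x ∧ 𝟙         ≡⟨ cong (x ∧_) e ⟨
    x ∧ (x ⇒ y)   ≤⟨ x∧[x⇒y]≤y x y ⟩
    y             ∎

  ≼-refl : ∀ x → x ≼ x
  ≼-refl x = 𝟙≤x⇒x≡𝟙 (subst₂ _≤_ (𝟙⇒x≡x 𝟙) (cong₂ _⇒_ (𝟙-greatest x) (𝟙-greatest x)) (C4 𝟙 𝟙 x))

  ⇒-antimonoˡ-≼ : ∀ {x y z} → x ≼ y → y ⇒ z ≼ x ⇒ z
  ⇒-antimonoˡ-≼ {x} {y} {z} e = ≼-mp e (C1 x y z)

  ⇒-monoʳ-≼ : ∀ {x y z} → y ≼ z → x ⇒ y ≼ x ⇒ z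
  ⇒-monoʳ-≼ {x} {y} {z} e =
    subst (λ t → x ⇒ y ≼ t) (trans (cong (_⇒ (x ⇒ z)) e) (𝟙⇒x≡x (x ⇒ z))) (C1 x y z)

  ≼-trans : ∀ {x y z} → x ≼ y → y ≼ z → x ≼ z
  ≼-trans e f = ≼-mp f (⇒-antimonoˡ-≼ e)

  ∧-monoʳ-≼ : ∀ {x y z} → x ≼ y → z ∧ x ≼ z ∧ y
  ∧-monoʳ-≼ {x} {y} {z} e = 𝟙≤x⇒x≡𝟙 (subst (_≤ z ∧ x ⇒ z ∧ y) e (C4 x y z))

  x≼¬¬x : ∀ x → x ≼ ¬ ¬ x
  x≼¬¬x x = subst₂ (λ s t → s ⇒ ¬ t ≡ 𝟙) (𝟙⇒x≡x x) (𝟙⇒x≡x (¬ x)) (C2 𝟙 x)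

  x≤¬¬x : ∀ x → x ≤ ¬ ¬ x
  x≤¬¬x x = ≼⇒≤ (x≼¬¬x x)

  ≼-intro : ∀ {x y} → x ≤ y → y ≤ ¬ ¬ x → x ≼ y
  ≼-intro {x} {y} p q = subst₂ _≼_ (trans (∧-comm y x) p) q (∧-monoʳ-≼ {z = y} (x≼¬¬x x))

  x≤[y⇒y∧x] : ∀ y x → x ≤ y ⇒ y ∧ x
  x≤[y⇒y∧x] y x = subst₂ _≤_ (𝟙⇒x≡x x) (cong (_⇒ y ∧ x) (𝟙-greatest y)) (C4 𝟙 x y)

  x∧¬x≡𝟘 : ∀ x → x ∧ ¬ x ≡ 𝟘
  x∧¬x≡𝟘 x = trans (C3 x 𝟘) (x∧𝟘≡𝟘 x)

  ¬x∧x≡𝟘 : ∀ x → ¬ x ∧ x ≡ 𝟘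
  ¬x∧x≡𝟘 x = trans (∧-comm (¬ x) x) (x∧¬x≡𝟘 x)

  x∧y≡𝟘⇒x≤¬y : ∀ {x y} → x ∧ y ≡ 𝟘 → x ≤ ¬ y
  x∧y≡𝟘⇒x≤¬y {x} {y} e = ≤-trans (x≤[y⇒y∧x] y x) (≤-reflexive (cong (y ⇒_) (trans (∧-comm y x) e)))

  x∧y≤𝟘⇒x≤¬y : ∀ {x y} → x ∧ y ≤ 𝟘 → x ≤ ¬ y
  x∧y≤𝟘⇒x≤¬y p = x∧y≡𝟘⇒x≤¬y (x≤𝟘⇒x≡𝟘 p)

  x≤¬y⇒x∧y≡𝟘 : ∀ {x y} → x ≤ ¬ y → x ∧ y ≡ 𝟘
  x≤¬y⇒x∧y≡𝟘 {x} {y} p = x≤𝟘⇒x≡𝟘 (begin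
    x ∧ y     ≤⟨ ∧-mono-≤ p ≤-refl ⟩
    ¬ y ∧ y   ≡⟨ ¬x∧x≡𝟘 y ⟩
    𝟘         ∎)

  x≤¬y⇒y≤¬x : ∀ {x y} → x ≤ ¬ y → y ≤ ¬ x
  x≤¬y⇒y≤¬x {x} {y} p = x∧y≡𝟘⇒x≤¬y (trans (∧-comm y x) (x≤¬y⇒x∧y≡𝟘 p))

  x≤¬x⇒x≡𝟘 : ∀ {x} → x ≤ ¬ x → x ≡ 𝟘
  x≤¬x⇒x≡𝟘 {x} p = trans (sym p) (x∧¬x≡𝟘 x)

  ¬-antitone : ∀ {x y} → x ≤ y → ¬ y ≤ ¬ x
  ¬-antitone {x} {y} p = x≤¬y⇒y≤¬x (≤-trans p (x≤¬¬x y))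

  ¬x≡𝟙⇒x≡𝟘 : ∀ {x} → ¬ x ≡ 𝟙 → x ≡ 𝟘
  ¬x≡𝟙⇒x≡𝟘 {x} e = x≤¬x⇒x≡𝟘 (≤-trans (𝟙-greatest x) (≤-reflexive (sym e)))

  x≤x⇒𝟙 : ∀ x → x ≤ x ⇒ 𝟙
  x≤x⇒𝟙 x = trans (C3 x 𝟙) (𝟙-greatest x)

  ¬¬¬x≡¬x : ∀ x → ¬ ¬ ¬ x ≡ ¬ x
  ¬¬¬x≡¬x x = ≤-antisym (¬-antitone (x≤¬¬x x)) (x≤¬¬x (¬ x))

  ¬x≡¬[x⇒𝟙] : ∀ x → ¬ x ≡ ¬ (x ⇒ 𝟙)
  ¬x≡¬[x⇒𝟙] x = ≤-antisym (subst (λ t → ¬ x ≤ ¬ (x ⇒ t)) (≼-refl 𝟘) (≼⇒≤ (C2 x 𝟘)))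
                          (¬-antitone (x≤x⇒𝟙 x))

  ¬x⇒𝟙≤𝟘⇒x : ∀ x → ¬ x ⇒ 𝟙 ≤ 𝟘 ⇒ x
  ¬x⇒𝟙≤𝟘⇒x x = subst (¬ x ⇒ 𝟙 ≤_) (cong₂ _⇒_ (x∧¬x≡𝟘 x) (𝟙-greatest x)) (C4 (¬ x) 𝟙 x)

  𝟘⇒x≤¬x : ∀ x → 𝟘 ⇒ x ≤ ¬ x
  𝟘⇒x≤¬x x = begin
    𝟘 ⇒ x               ≤⟨ ≼⇒≤ (C2 𝟘 x) ⟩
    ¬ (𝟘 ⇒ ¬ x)         ≤⟨ ¬-antitone (¬x⇒𝟙≤𝟘⇒x (¬ x)) ⟩
    ¬ (¬ ¬ x ⇒ 𝟙)       ≡⟨ ¬x≡¬[x⇒𝟙] (¬ ¬ x) ⟨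
    ¬ ¬ ¬ x             ≡⟨ ¬¬¬x≡¬x x ⟩
    ¬ x                 ∎

  𝟘⇒x≡¬x : ∀ x → 𝟘 ⇒ x ≡ ¬ x
  𝟘⇒x≡¬x x = ≤-antisym (𝟘⇒x≤¬x x) (≤-trans (x≤x⇒𝟙 (¬ x)) (¬x⇒𝟙≤𝟘⇒x x))

  ¬x⇒𝟙≡¬x : ∀ x → ¬ x ⇒ 𝟙 ≡ ¬ x
  ¬x⇒𝟙≡¬x x = ≤-antisym (≤-trans (¬x⇒𝟙≤𝟘⇒x x) (𝟘⇒x≤¬x x)) (x≤x⇒𝟙 (¬ x))

  𝟘≼x⇒x≡𝟘 : ∀ {x} → 𝟘 ≼ x → x ≡ 𝟘
  𝟘≼x⇒x≡𝟘 {x} e = ¬x≡𝟙⇒x≡𝟘 (trans (sym (𝟘⇒x≡¬x x)) e)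

  ¬¬x≡x⇒𝟙 : ∀ x → ¬ ¬ x ≡ x ⇒ 𝟙
  ¬¬x≡x⇒𝟙 x = ≤-antisym
    (≤-trans (≤-reflexive (sym (¬x⇒𝟙≡¬x (¬ x)))) (≼⇒≤ (⇒-antimonoˡ-≼ (x≼¬¬x x))))
    (subst (λ t → x ⇒ 𝟙 ≤ ¬ (x ⇒ t)) (𝟙⇒x≡x 𝟘) (≼⇒≤ (C2 x 𝟙)))

  ≼⇒¬≡ : ∀ {x y} → x ≼ y → ¬ x ≡ ¬ y
  ≼⇒¬≡ {x} {y} e = ≤-antisym (x∧y≡𝟘⇒x≤¬y ¬x∧y≡𝟘) (¬-antitone (≼⇒≤ e))
    where
      ¬x∧y≡𝟘 : ¬ x ∧ y ≡ 𝟘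
      ¬x∧y≡𝟘 = 𝟘≼x⇒x≡𝟘 (subst (_≼ ¬ x ∧ y) (¬x∧x≡𝟘 x) (∧-monoʳ-≼ e))

  [x⇒y]∧[y⇒z]≤x⇒z : ∀ x y z → (x ⇒ y) ∧ (y ⇒ z) ≤ x ⇒ z
  [x⇒y]∧[y⇒z]≤x⇒z x y z = begin
    (x ⇒ y) ∧ (y ⇒ z)               ≤⟨ ∧-greatest (x∧y≤y _ _) (≤-trans (x∧y≤x _ _) (≼⇒≤ (C1 x y z))) ⟩
    (y ⇒ z) ∧ ((y ⇒ z) ⇒ (x ⇒ z))   ≤⟨ x∧[x⇒y]≤y (y ⇒ z) (x ⇒ z) ⟩
    x ⇒ z                           ∎

  ¬x∧¬y≤x⇒y : ∀ x y → ¬ x ∧ ¬ y ≤ x ⇒ y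
  ¬x∧¬y≤x⇒y x y = subst (λ t → ¬ x ∧ t ≤ x ⇒ y) (𝟘⇒x≡¬x y) ([x⇒y]∧[y⇒z]≤x⇒z x 𝟘 y)

  x⇒y≤¬¬y⇒¬¬x : ∀ x y → x ⇒ y ≤ ¬ ¬ y ⇒ ¬ ¬ x
  x⇒y≤¬¬y⇒¬¬x x y = subst (x ⇒ y ≤_) (sym (cong₂ _⇒_ (¬¬x≡x⇒𝟙 y) (¬¬x≡x⇒𝟙 x))) (≼⇒≤ (C1 x y 𝟙))

  ¬x∧[x⇒y]≤¬y : ∀ x y → ¬ x ∧ (x ⇒ y) ≤ ¬ y
  ¬x∧[x⇒y]≤¬y x y = x∧y≤𝟘⇒x≤¬y (begin
    (¬ x ∧ (x ⇒ y)) ∧ y     ≤⟨ ∧-greatest (≤-trans (x∧y≤x _ _) (x∧y≤x _ _)) ≤¬¬x ⟩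
    ¬ x ∧ ¬ ¬ x             ≡⟨ x∧¬x≡𝟘 (¬ x) ⟩
    𝟘                       ∎)
    where
      ≤¬¬x : (¬ x ∧ (x ⇒ y)) ∧ y ≤ ¬ ¬ x
      ≤¬¬x = begin
        (¬ x ∧ (x ⇒ y)) ∧ y             ≤⟨ ∧-greatest (≤-trans (x∧y≤y _ _) (x≤¬¬x y))
                                                      (≤-trans (x∧y≤x _ _) (≤-trans (x∧y≤y _ _) (x⇒y≤¬¬y⇒¬¬x x y))) ⟩
        ¬ ¬ y ∧ (¬ ¬ y ⇒ ¬ ¬ x)         ≤⟨ x∧[x⇒y]≤y (¬ ¬ y) (¬ ¬ x) ⟩
        ¬ ¬ x                           ∎

  x⇒¬y≤y⇒¬x : ∀ x y → x ⇒ ¬ y ≤ y ⇒ ¬ x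
  x⇒¬y≤y⇒¬x x y = ≤-trans (≼⇒≤ (C1 x (¬ y) 𝟘)) (≼⇒≤ (⇒-antimonoˡ-≼ (x≼¬¬x y)))

  x⇒¬y≡y⇒¬x : ∀ x y → x ⇒ ¬ y ≡ y ⇒ ¬ x
  x⇒¬y≡y⇒¬x x y = ≤-antisym (x⇒¬y≤y⇒¬x x y) (x⇒¬y≤y⇒¬x y x)

  -- _⇒_ is not monotone for ≤, so z is enlarged to z ∨ y, for which x ∧ (z ∨ y) is exactly x ∧ y.
  x∧z≤y⇒z≤x⇒x∧y : ∀ {x y z} → x ∧ z ≤ y → z ≤ x ⇒ x ∧ y
  x∧z≤y⇒z≤x⇒x∧y {x} {y} {z} p = begin
    z                   ≤⟨ x≤x∨y z y ⟩
    z ∨ y               ≤⟨ x≤[y⇒y∧x] x (z ∨ y) ⟩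
    x ⇒ x ∧ (z ∨ y)     ≡⟨ cong (x ⇒_) x∧[z∨y]≡x∧y ⟩
    x ⇒ x ∧ y           ∎
    where
      x∧[z∨y]≡x∧y : x ∧ (z ∨ y) ≡ x ∧ y
      x∧[z∨y]≡x∧y = trans (∧-distribˡ-∨ x z y)
        (≤-antisym (∨-least (∧-greatest (x∧y≤x x z) p) ≤-refl) (y≤x∨y (x ∧ z) (x ∧ y)))

  [x∧y]∨[¬x∧y]≼y : ∀ x y → (x ∧ y) ∨ (¬ x ∧ y) ≼ y
  [x∧y]∨[¬x∧y]≼y x y = ≼-intro (∨-least (x∧y≤y x y) (x∧y≤y (¬ x) y)) y≤¬¬q
    where
      q = (x ∧ y) ∨ (¬ x ∧ y)

      y∧¬q≤¬ : ∀ w → w ∧ y ≤ q → y ∧ ¬ q ≤ ¬ w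
      y∧¬q≤¬ w p = x∧y≤𝟘⇒x≤¬y (begin
        (y ∧ ¬ q) ∧ w       ≤⟨ ∧-greatest (≤-trans (x∧y≤x _ _) (≤-trans (x∧y≤y _ _) (¬-antitone p)))
                                          (∧-greatest (x∧y≤y _ _) (≤-trans (x∧y≤x _ _) (x∧y≤x _ _))) ⟩
        ¬ (w ∧ y) ∧ w ∧ y   ≡⟨ ¬x∧x≡𝟘 (w ∧ y) ⟩
        𝟘                   ∎)

      y≤¬¬q : y ≤ ¬ ¬ q
      y≤¬¬q = x∧y≤𝟘⇒x≤¬y (begin
        y ∧ ¬ q         ≤⟨ ∧-greatest (y∧¬q≤¬ x (x≤x∨y _ _)) (y∧¬q≤¬ (¬ x) (y≤x∨y _ _)) ⟩
        ¬ x ∧ ¬ ¬ x     ≡⟨ x∧¬x≡𝟘 (¬ x) ⟩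
        𝟘               ∎)

  ¬[¬x∧y]≤x∧y⇒y : ∀ x y → ¬ (¬ x ∧ y) ≤ x ∧ y ⇒ y
  ¬[¬x∧y]≤x∧y⇒y x y = begin
    ¬ (¬ x ∧ y)                                 ≡⟨ 𝟘⇒x≡¬x (¬ x ∧ y) ⟨
    𝟘 ⇒ ¬ x ∧ y                                 ≤⟨ C5 𝟘 (¬ x ∧ y) (x ∧ y) ⟩
    (x ∧ y) ∨ 𝟘 ⇒ (x ∧ y) ∨ (¬ x ∧ y)           ≡⟨ cong (_⇒ (x ∧ y) ∨ (¬ x ∧ y)) (x∨𝟘≡x (x ∧ y)) ⟩
    x ∧ y ⇒ (x ∧ y) ∨ (¬ x ∧ y)                 ≤⟨ ≼⇒≤ (⇒-monoʳ-≼ ([x∧y]∨[¬x∧y]≼y x y)) ⟩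
    x ∧ y ⇒ y                                   ∎

  ⇒-intro : ∀ {x y z} → x ∧ z ≤ y → z ≤ ¬ (¬ x ∧ y) → z ≤ x ⇒ y
  ⇒-intro {x} {y} {z} p q = begin
    z                               ≤⟨ ∧-greatest (x∧z≤y⇒z≤x⇒x∧y p) (≤-trans q (¬[¬x∧y]≤x∧y⇒y x y)) ⟩
    (x ⇒ x ∧ y) ∧ (x ∧ y ⇒ y)       ≤⟨ [x⇒y]∧[y⇒z]≤x⇒z x (x ∧ y) y ⟩
    x ⇒ y                           ∎

  x⇒¬y≼¬[x⇒y] : ∀ x y → x ⇒ ¬ y ≼ ¬ (x ⇒ y)
  x⇒¬y≼¬[x⇒y] x y = ≼-trans (C2 x (¬ y)) (⇒-antimonoˡ-≼ (⇒-monoʳ-≼ (x≼¬¬x y)))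

  ¬[x⇒y]≡x⇒¬y : ∀ x y → ¬ (x ⇒ y) ≡ x ⇒ ¬ y
  ¬[x⇒y]≡x⇒¬y x y = ≤-antisym (⇒-intro x∧¬[x⇒y]≤¬y (¬-antitone (¬x∧¬y≤x⇒y x y)))
                              (≼⇒≤ (x⇒¬y≼¬[x⇒y] x y))
    where
      x∧¬[x⇒y]≤¬y : x ∧ ¬ (x ⇒ y) ≤ ¬ y
      x∧¬[x⇒y]≤¬y = x∧y≤𝟘⇒x≤¬y (begin
        (x ∧ ¬ (x ⇒ y)) ∧ y       ≤⟨ ∧-greatest (≤-trans (x∧y≤x _ _) (x∧y≤y _ _)) (∧-mono-≤ (x∧y≤x _ _) ≤-refl) ⟩
        ¬ (x ⇒ y) ∧ x ∧ y         ≤⟨ ∧-mono-≤ ≤-refl (x∧y≤x⇒y x y) ⟩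
        ¬ (x ⇒ y) ∧ (x ⇒ y)       ≡⟨ ¬x∧x≡𝟘 (x ⇒ y) ⟩
        𝟘                         ∎)

  ¬[x⇒y]≡¬[y⇒x] : ∀ x y → ¬ (x ⇒ y) ≡ ¬ (y ⇒ x)
  ¬[x⇒y]≡¬[y⇒x] x y = begin-equality
    ¬ (x ⇒ y)   ≡⟨ ¬[x⇒y]≡x⇒¬y x y ⟩
    x ⇒ ¬ y     ≡⟨ x⇒¬y≡y⇒¬x x y ⟩
    y ⇒ ¬ x     ≡⟨ ¬[x⇒y]≡x⇒¬y y x ⟨
    ¬ (y ⇒ x)   ∎

  [x⇒y]∧[x⇒¬y]≡𝟘 : ∀ x y → (x ⇒ y) ∧ (x ⇒ ¬ y) ≡ 𝟘
  [x⇒y]∧[x⇒¬y]≡𝟘 x y = x≤¬y⇒x∧y≡𝟘 (≼⇒≤ (C2 x y))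

  ¬[x⇒¬x]≡𝟙 : ∀ x → ¬ (x ⇒ ¬ x) ≡ 𝟙
  ¬[x⇒¬x]≡𝟙 x = ≼-mp (≼-refl x) (C2 x x)

  x⇒¬x≡𝟘 : ∀ x → x ⇒ ¬ x ≡ 𝟘
  x⇒¬x≡𝟘 x = ¬x≡𝟙⇒x≡𝟘 (¬[x⇒¬x]≡𝟙 x)

  ¬x⇒x≡𝟘 : ∀ x → ¬ x ⇒ x ≡ 𝟘
  ¬x⇒x≡𝟘 x = x≤𝟘⇒x≡𝟘 (≤-trans (≼⇒≤ (⇒-monoʳ-≼ (x≼¬¬x x))) (≤-reflexive (x⇒¬x≡𝟘 (¬ x))))

  [x⇒y]⇒[x⇒¬y]≡𝟘 : ∀ x y → (x ⇒ y) ⇒ (x ⇒ ¬ y) ≡ 𝟘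
  [x⇒y]⇒[x⇒¬y]≡𝟘 x y =
    x≤𝟘⇒x≡𝟘 (≤-trans (≼⇒≤ (⇒-monoʳ-≼ (x⇒¬y≼¬[x⇒y] x y))) (≤-reflexive (x⇒¬x≡𝟘 (x ⇒ y))))

  x≼y⇒x⇒¬y≡𝟘 : ∀ {x y} → x ≼ y → x ⇒ ¬ y ≡ 𝟘
  x≼y⇒x⇒¬y≡𝟘 {x} {y} e = ¬x≡𝟙⇒x≡𝟘 (≼-mp e (C2 x y))

  x⇒y≡𝟘⇔x⇒¬y≡𝟙 : ∀ x y → (x ⇒ y ≡ 𝟘) ⇔ (x ⇒ ¬ y ≡ 𝟙)
  x⇒y≡𝟘⇔x⇒¬y≡𝟙 x y = mk⇔
    (λ e → trans (sym (¬[x⇒y]≡x⇒¬y x y)) (trans (cong ¬_ e) (≼-refl 𝟘)))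
    (λ e → x≤𝟘⇒x≡𝟘 (≤-trans (≼⇒≤ (⇒-monoʳ-≼ (x≼¬¬x y))) (≤-reflexive (x≼y⇒x⇒¬y≡𝟘 e))))

  x⇒𝟙≤y⇒[x⇒y] : ∀ x y → x ⇒ 𝟙 ≤ y ⇒ (x ⇒ y)
  x⇒𝟙≤y⇒[x⇒y] x y = ≼⇒≤ (subst (λ t → x ⇒ 𝟙 ≼ t ⇒ (x ⇒ y)) (𝟙⇒x≡x y) (C1 x 𝟙 y))

  x≼[x⇒y]⇒y : ∀ x y → x ≼ (x ⇒ y) ⇒ y
  x≼[x⇒y]⇒y x y = subst₂ (λ s t → s ≼ (x ⇒ y) ⇒ t) (𝟙⇒x≡x x) (𝟙⇒x≡x y) (C1 𝟙 x y)

  [x⇒y]≤[z⇒x]⇒[z⇒y] : ∀ x y z → x ⇒ y ≤ (z ⇒ x) ⇒ (z ⇒ y)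
  [x⇒y]≤[z⇒x]⇒[z⇒y] x y z = ⇒-intro ([x⇒y]∧[y⇒z]≤x⇒z z x y) (x≤¬y⇒y≤¬x ≤¬[x⇒y])
    where
      ≤¬[x⇒y] : ¬ (z ⇒ x) ∧ (z ⇒ y) ≤ ¬ (x ⇒ y)
      ≤¬[x⇒y] = ≤-trans (x∧y≤𝟘⇒x≤¬y (begin
        (¬ (z ⇒ x) ∧ (z ⇒ y)) ∧ (y ⇒ x)   ≤⟨ ∧-greatest (≤-trans (x∧y≤x _ _) (x∧y≤x _ _))
                                                        (∧-mono-≤ (x∧y≤y _ _) ≤-refl) ⟩
        ¬ (z ⇒ x) ∧ (z ⇒ y) ∧ (y ⇒ x)     ≤⟨ ∧-mono-≤ ≤-refl ([x⇒y]∧[y⇒z]≤x⇒z z y x) ⟩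
        ¬ (z ⇒ x) ∧ (z ⇒ x)               ≡⟨ ¬x∧x≡𝟘 (z ⇒ x) ⟩
        𝟘                                 ∎))
        (≤-reflexive (¬[x⇒y]≡¬[y⇒x] y x))

  [¬x⇒¬y]∧[x⇒¬y]≡𝟘 : ∀ x y → (¬ x ⇒ ¬ y) ∧ (x ⇒ ¬ y) ≡ 𝟘
  [¬x⇒¬y]∧[x⇒¬y]≡𝟘 x y = begin-equality
    (¬ x ⇒ ¬ y) ∧ (x ⇒ ¬ y)     ≡⟨ cong₂ _∧_ (x⇒¬y≡y⇒¬x (¬ x) y) (x⇒¬y≡y⇒¬x x y) ⟩
    (y ⇒ ¬ ¬ x) ∧ (y ⇒ ¬ x)     ≡⟨ ∧-comm (y ⇒ ¬ ¬ x) (y ⇒ ¬ x) ⟩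
    (y ⇒ ¬ x) ∧ (y ⇒ ¬ ¬ x)     ≡⟨ [x⇒y]∧[x⇒¬y]≡𝟘 y (¬ x) ⟩
    𝟘                           ∎

  [z⇒¬y]∧[x⇒¬y]≤¬¬[z⇒x] : ∀ x y z → (z ⇒ ¬ y) ∧ (x ⇒ ¬ y) ≤ ¬ ¬ (z ⇒ x)
  [z⇒¬y]∧[x⇒¬y]≤¬¬[z⇒x] x y z = begin
    (z ⇒ ¬ y) ∧ (x ⇒ ¬ y)     ≤⟨ x∧y≤𝟘⇒x≤¬y ∧[¬x⇒z]≤𝟘 ⟩
    ¬ (¬ x ⇒ z)               ≡⟨ ¬[x⇒y]≡¬[y⇒x] (¬ x) z ⟩
    ¬ (z ⇒ ¬ x)               ≡⟨ cong ¬_ (¬[x⇒y]≡x⇒¬y z x) ⟨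
    ¬ ¬ (z ⇒ x)               ∎
    where
      ∧[¬x⇒z]≤𝟘 : ((z ⇒ ¬ y) ∧ (x ⇒ ¬ y)) ∧ (¬ x ⇒ z) ≤ 𝟘
      ∧[¬x⇒z]≤𝟘 = begin
        ((z ⇒ ¬ y) ∧ (x ⇒ ¬ y)) ∧ (¬ x ⇒ z)   ≤⟨ ∧-greatest (≤-trans (∧-greatest (x∧y≤y _ _) (≤-trans (x∧y≤x _ _) (x∧y≤x _ _)))
                                                                     ([x⇒y]∧[y⇒z]≤x⇒z (¬ x) z (¬ y)))
                                                            (≤-trans (x∧y≤x _ _) (x∧y≤y _ _)) ⟩
        (¬ x ⇒ ¬ y) ∧ (x ⇒ ¬ y)               ≡⟨ [¬x⇒¬y]∧[x⇒¬y]≡𝟘 x y ⟩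
        𝟘                                     ∎

  [z⇒x]⇒[z⇒y]≤¬¬[x⇒y] : ∀ x y z → (z ⇒ x) ⇒ (z ⇒ y) ≤ ¬ ¬ (x ⇒ y)
  [z⇒x]⇒[z⇒y]≤¬¬[x⇒y] x y z = x∧y≤𝟘⇒x≤¬y (begin
    R ∧ ¬ (x ⇒ y)                 ≤⟨ ∧-greatest ≤¬[z⇒x] ≤¬¬[z⇒x] ⟩
    ¬ (z ⇒ x) ∧ ¬ ¬ (z ⇒ x)       ≡⟨ x∧¬x≡𝟘 (¬ (z ⇒ x)) ⟩
    𝟘                             ∎)
    where
      R = (z ⇒ x) ⇒ (z ⇒ y)

      ≤¬[z⇒x] : R ∧ ¬ (x ⇒ y) ≤ ¬ (z ⇒ x)
      ≤¬[z⇒x] = x∧y≤𝟘⇒x≤¬y (begin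
        (R ∧ ¬ (x ⇒ y)) ∧ (z ⇒ x)                  ≤⟨ ∧-greatest (∧-greatest (x∧y≤y _ _) (≤-trans (x∧y≤x _ _) (x∧y≤x _ _)))
                                                                (∧-greatest (x∧y≤y _ _) (≤-trans (x∧y≤x _ _) (x∧y≤y _ _))) ⟩
        ((z ⇒ x) ∧ R) ∧ ((z ⇒ x) ∧ ¬ (x ⇒ y))     ≡⟨ cong (λ t → ((z ⇒ x) ∧ R) ∧ ((z ⇒ x) ∧ t)) (¬[x⇒y]≡x⇒¬y x y) ⟩
        ((z ⇒ x) ∧ R) ∧ ((z ⇒ x) ∧ (x ⇒ ¬ y))     ≤⟨ ∧-mono-≤ (x∧[x⇒y]≤y (z ⇒ x) (z ⇒ y)) ([x⇒y]∧[y⇒z]≤x⇒z z x (¬ y)) ⟩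
        (z ⇒ y) ∧ (z ⇒ ¬ y)                        ≡⟨ [x⇒y]∧[x⇒¬y]≡𝟘 z y ⟩
        𝟘                                          ∎)

      ≤¬¬[z⇒x] : R ∧ ¬ (x ⇒ y) ≤ ¬ ¬ (z ⇒ x)
      ≤¬¬[z⇒x] = begin
        R ∧ ¬ (x ⇒ y)                  ≤⟨ ∧-greatest (≤-trans (∧-greatest ≤¬[z⇒x] (x∧y≤x _ _)) (¬x∧[x⇒y]≤¬y (z ⇒ x) (z ⇒ y)))
                                                     (x∧y≤y _ _) ⟩
        ¬ (z ⇒ y) ∧ ¬ (x ⇒ y)          ≡⟨ cong₂ _∧_ (¬[x⇒y]≡x⇒¬y z y) (¬[x⇒y]≡x⇒¬y x y) ⟩
        (z ⇒ ¬ y) ∧ (x ⇒ ¬ y)          ≤⟨ [z⇒¬y]∧[x⇒¬y]≤¬¬[z⇒x] x y z ⟩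
        ¬ ¬ (z ⇒ x)                    ∎

  [x⇒y]≼[z⇒x]⇒[z⇒y] : ∀ x y z → x ⇒ y ≼ (z ⇒ x) ⇒ (z ⇒ y)
  [x⇒y]≼[z⇒x]⇒[z⇒y] x y z = ≼-intro ([x⇒y]≤[z⇒x]⇒[z⇒y] x y z) ([z⇒x]⇒[z⇒y]≤¬¬[x⇒y] x y z)

  ¬y≡¬x⇒[y⇒x] : ∀ x y → ¬ y ≡ ¬ x ⇒ (y ⇒ x)
  ¬y≡¬x⇒[y⇒x] x y = ≤-antisym
    (subst (λ t → ¬ y ≤ t ⇒ (y ⇒ x)) (𝟘⇒x≡¬x x) (≼⇒≤ (C1 y 𝟘 x)))
    (x∧y≤𝟘⇒x≤¬y (begin
      X ∧ y             ≤⟨ ∧-greatest (≤-trans (∧-greatest (x∧y≤y _ _) ≤y⇒¬x) (x∧[x⇒y]≤y y (¬ x))) ≤¬¬x ⟩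
      ¬ x ∧ ¬ ¬ x       ≡⟨ x∧¬x≡𝟘 (¬ x) ⟩
      𝟘                 ∎))
    where
      X = ¬ x ⇒ (y ⇒ x)

      ≤¬¬x : X ∧ y ≤ ¬ ¬ x
      ≤¬¬x = x∧y≤𝟘⇒x≤¬y (begin
        (X ∧ y) ∧ ¬ x             ≤⟨ ∧-greatest (x∧y≤y _ _) (∧-greatest (≤-trans (x∧y≤x _ _) (x∧y≤y _ _))
                                                                 (∧-greatest (x∧y≤y _ _) (≤-trans (x∧y≤x _ _) (x∧y≤x _ _)))) ⟩
        ¬ x ∧ y ∧ ¬ x ∧ X         ≤⟨ ∧-mono-≤ ≤-refl (∧-mono-≤ ≤-refl (x∧[x⇒y]≤y (¬ x) (y ⇒ x))) ⟩
        ¬ x ∧ y ∧ (y ⇒ x)         ≤⟨ ∧-mono-≤ ≤-refl (x∧[x⇒y]≤y y x) ⟩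
        ¬ x ∧ x                   ≡⟨ ¬x∧x≡𝟘 x ⟩
        𝟘                         ∎)

      ≤y⇒¬x : X ∧ y ≤ y ⇒ ¬ x
      ≤y⇒¬x = begin
        X ∧ y                     ≤⟨ ∧-greatest ≤¬¬x (x∧y≤x _ _) ⟩
        ¬ ¬ x ∧ X                 ≤⟨ ¬x∧[x⇒y]≤¬y (¬ x) (y ⇒ x) ⟩
        ¬ (y ⇒ x)                 ≡⟨ ¬[x⇒y]≡x⇒¬y y x ⟩
        y ⇒ ¬ x                   ∎

open ConnexiveHeytingAlgebraProperties

lemma3p6 : {ℓ : Level} (A : ConnexiveHeytingAlgebra ℓ) →
    let open ConnexiveHeytingAlgebra A in
    ∀ a b c →
      ((a ⇒ b) ∧ (b ⇒ c) ≤ a ⇒ c)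
    × ((a ⇒ b) ⇒ ((c ⇒ a) ⇒ (c ⇒ b)) ≡ 𝟙)
    × (a ≤ b → ¬ b ≤ ¬ a)
    × ((a ≤ a ⇒ 𝟙) × (a ⇒ 𝟙 ≤ b ⇒ (a ⇒ b)))
    × (¬ a ≡ 𝟙 → a ≡ 𝟘)
    × (¬ (a ⇒ ¬ a) ≡ 𝟙)
    × ((a ⇒ ¬ a ≡ 𝟘) × (𝟘 ≡ ¬ a ⇒ a))
    × ((a ⇒ b) ∧ (a ⇒ ¬ b) ≡ 𝟘)
    × ((a ⇒ b) ⇒ (a ⇒ ¬ b) ≡ 𝟘)
    × ((a ⇒ 𝟙) ⇒ ¬ a ≡ 𝟘)
    × (𝟘 ⇒ a ≡ (a ⇒ 𝟘) ⇒ 𝟙)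
    × (a ⇒ ¬ ¬ a ≡ 𝟙)
    × (𝟘 ⇒ a ≡ a ⇒ 𝟘)
    × ((¬ b ≡ ¬ ((b ⇒ a) ⇒ a)) × (¬ ((b ⇒ a) ⇒ a) ≡ ¬ a ⇒ (b ⇒ a)))
    × ((a ⇒ 𝟙) ∧ ¬ a ≡ 𝟘)
    × (¬ a ≡ (a ⇒ 𝟙) ⇒ 𝟘)
    × ((a ⇒ b) ⇒ 𝟙 ≡ ¬ (a ⇒ ¬ b))
    × (¬ ¬ a ≡ a ⇒ 𝟙)
    × (¬ (a ⇒ b) ≡ ¬ (b ⇒ a))
    × (¬ (a ⇒ b) ≡ a ⇒ ¬ b)
    × ((a ⇒ b ≡ 𝟘) ⇔ (a ⇒ ¬ b ≡ 𝟙))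
    × (a ⇒ b ≡ 𝟙 → a ⇒ ¬ b ≡ 𝟘)
lemma3p6 A a b c =
    [x⇒y]∧[y⇒z]≤x⇒z A a b c
  , [x⇒y]≼[z⇒x]⇒[z⇒y] A a b c
  , ¬-antitone A
  , (x≤x⇒𝟙 A a , x⇒𝟙≤y⇒[x⇒y] A a b)
  , ¬x≡𝟙⇒x≡𝟘 A
  , ¬[x⇒¬x]≡𝟙 A a
  , (x⇒¬x≡𝟘 A a , sym (¬x⇒x≡𝟘 A a))
  , [x⇒y]∧[x⇒¬y]≡𝟘 A a b
  , [x⇒y]⇒[x⇒¬y]≡𝟘 A a b
  , trans (cong ((a ⇒ 𝟙) ⇒_) (¬x≡¬[x⇒𝟙] A a)) (x⇒¬x≡𝟘 A (a ⇒ 𝟙))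
  , trans (𝟘⇒x≡¬x A a) (sym (¬x⇒𝟙≡¬x A a))
  , x≼¬¬x A a
  , 𝟘⇒x≡¬x A a
  , (¬b≡¬[[b⇒a]⇒a] , trans (sym ¬b≡¬[[b⇒a]⇒a]) (¬y≡¬x⇒[y⇒x] A a b))
  , trans (cong (_∧ ¬ a) (sym (¬¬x≡x⇒𝟙 A a))) (¬x∧x≡𝟘 A (¬ a))
  , ¬x≡¬[x⇒𝟙] A a
  , trans (sym (¬¬x≡x⇒𝟙 A (a ⇒ b))) (cong ¬_ (¬[x⇒y]≡x⇒¬y A a b))
  , ¬¬x≡x⇒𝟙 A a
  , ¬[x⇒y]≡¬[y⇒x] A a b
  , ¬[x⇒y]≡x⇒¬y A a b
  , x⇒y≡𝟘⇔x⇒¬y≡𝟙 A a b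
  , x≼y⇒x⇒¬y≡𝟘 A
  where
    open ConnexiveHeytingAlgebra A
    ¬b≡¬[[b⇒a]⇒a] : ¬ b ≡ ¬ ((b ⇒ a) ⇒ a)
    ¬b≡¬[[b⇒a]⇒a] = ≼⇒¬≡ A (x≼[x⇒y]⇒y A b a)
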